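{- Let $n$ be a positive integer and let $\lambda$ be a partition whose set of first column hook lengths $H_\lambda=\{h_1>h_2>\dots>h_a\}$ ($a\ge 1$) is $n$-flush. Then $H_{\lambda^T}$ is also $n$-flush, and $$S^n(H_\lambda)=\{h_1+n-s: s\in S^n(H_{\lambda^T})\}.$$
   Context: A partition $\lambda=(\lambda_1\ge\dots\ge\lambda_a>0)$ is identified with its Young diagram (row $i$ has $\lambda_i$ left-justified boxes, rows from top). The hook length of a box is $1+$ (number of boxes to its right in its row) $+$ (number of boxes below it in its column). $\lambda^T$ is the conjugate partition (diagram reflected in the main diagonal). $H_\lambda=\{\lambda_i+a-i:1\le i\le a\}$ is the set of hook lengths of the boxes in the first column of $\lambda$; note $H_{\lambda^T}$ is the set of hook lengths of the first row of $\lambda$. For a finite set $H$ of positive integers and $0\le i\le n-1$, let $s_i^n(H)$ be the largest element of $\big((n+H)\cup\{i\}\big)\cap(i+n\mathbb Z)$, where $n+H=\{n+h:h\in H\}$ (so $s_i^n(H)=n+\max\{h\in H: h\equiv i \bmod n\}$ if such $h$ exists, and $s_i^n(H)=i$ otherwise), and let $S^n(H)=\{s_0^n(H),\dots,s_{n-1}^n(H)\}$. The set $H$ is $n$-flush if no element of $H$ is divisible by $n$ and for every $h\in H$, $h-n$ is either negative or belongs to $H$. -}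

module Defs where

open import Data.Nat using (ℕ; zero; suc; _+_; _∸_; _<_; _≤_; _≥_; _⊔_; _≤?_; _≟_; NonZero)
open import Data.Nat.DivMod using (_%_)
open import Data.Nat.Divisibility using (_∣_)
open import Data.List using (List; []; _∷_; map; length; filter; foldr; upTo)
open import Data.List.Relation.Unary.All using (All)
open import Data.List.Relation.Unary.Linked using (Linked)
open import Data.List.Membership.Propositional using (_∈_)
open import Data.Product using (_×_)
open import Data.Sum using (_⊎_)
open import Data.Bool using (if_then_else_)
open import Relation.Nullary using (¬_; does)

IsPartition : List ℕ → Set
IsPartition l = All (λ x → 0 < x) l × Linked _≥_ l

maxPart : List ℕ → ℕ
maxPart = foldr _⊔_ 0

-- Conjugate partition: (λᵀ)ⱼ = #{ i : λᵢ ≥ j } for j = 1 … λ₁.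
conj : List ℕ → List ℕ
conj l = map (λ j → length (filter (suc j ≤?_) l)) (upTo (maxPart l))

-- H_λ = { λᵢ + a − i : 1 ≤ i ≤ a }, listed in order i = 1 … a
-- (a − i is the number of parts after the i-th one).
H : List ℕ → List ℕ
H [] = []
H (x ∷ xs) = (x + length xs) ∷ H xs

Flush : ℕ → List ℕ → Set
Flush n Hs = ∀ h → h ∈ Hs → ¬ (n ∣ h) × (h < n ⊎ (h ∸ n) ∈ Hs)

-- s_i^n(H): the largest element of ((n + H) ∪ {i}) ∩ (i + nℤ), for 0 ≤ i < n.
-- Since 0 ≤ i < n, an element h ∈ H satisfies n + h ∈ i + nℤ iff h % n = i.
s : (n : ℕ) → .{{NonZero n}} → List ℕ → ℕ → ℕ
s n Hs i = foldr (λ h acc → if does (h % n ≟ i) then (n + h) ⊔ acc else acc) i Hs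

S : (n : ℕ) → .{{NonZero n}} → List ℕ → List ℕ
S n Hs = map (s n Hs) (upTo n)

module Submission where

-- 1. First gaps.  Every y ∈ Sⁿ(L) is a "first gap" of L: y ∉ L, and y < n or
--    y - n ∈ L.  For n-flush L the converse holds, so Sⁿ(L) is exactly the set
--    of first gaps of L.
-- 2. Reflected complements.  Call B the reflected complement of A in
--    {0, …, h} if g ∈ B ⇔ (g ≤ h and h - g ∉ A).  If A ⊆ {0, …, h}, this
--    relation is symmetric, it transports n-flushness from A (when h ∈ A) to B,
--    and y ↦ h + n - y maps the first gaps of A onto those of B.
-- 3. Conjugation.  H_{λᵀ} is the reflected complement of H_λ in {0, …, h}.
--    This is proved by induction on the rows: adding a row of length y + d on
--    top of μ = (y, …) shifts the first-row hooks of μ up by d + 1 and adds the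
--    hooks 1, …, d of the new short columns.
-- The theorem is 2 applied to the pair of 3, read through 1.

open import Defs
open import Data.Nat
open import Data.Nat.Properties
open import Data.Nat.DivMod using (m≡m%n+[m/n]*n; /-monoˡ-≤; [m+n]%n≡m%n; m<n⇒m%n≡m; m%n<n; m%n≤m; m≤n⇒[n∸m]%m≡n%m)
open import Data.Nat.Divisibility using (_∣_; divides)
open import Data.Nat.Tactic.RingSolver using (solve-∀)
open import Data.Bool using (true; false; T)
open import Data.Unit using (tt)
open import Data.Empty using (⊥-elim)
open import Data.List using (List; []; _∷_; length; filter; applyUpTo)
open import Data.List.Properties using (filter-accept; filter-none; length-applyUpTo; map-upTo)
open import Data.List.Relation.Unary.All as All using (All; [])
open import Data.List.Relation.Unary.Any using (here; there)
open import Data.List.Relation.Unary.Linked using (Linked; [-]; _∷_)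
open import Data.List.Relation.Unary.Linked.Properties using (Linked⇒All)
open import Data.List.Membership.Propositional using (_∈_; _∉_)
open import Data.List.Membership.Propositional.Properties using (∈-map⁺; ∈-map⁻; ∈-upTo⁺; ∈-upTo⁻)
open import Data.List.Membership.DecPropositional _≟_ using (_∈?_)
open import Data.Product using (∃; _×_; _,_; proj₁; proj₂)
open import Data.Sum as Sum using (_⊎_; inj₁; inj₂)
open import Function using (_∘_)
open import Function.Bundles using (_⇔_; mk⇔; Equivalence)
open import Relation.Nullary using (¬_; yes; no)
open import Relation.Binary.PropositionalEquality

open Equivalence using (to; from)

∸-cancel-+ : ∀ a b k → (a + k) ∸ (b + k) ≡ a ∸ b
∸-cancel-+ a b k = trans (cong₂ _∸_ (+-comm a k) (+-comm b k)) ([m+n]∸[m+o]≡n∸o k a b)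

∸-exchange : ∀ a b c d → a + b ≡ c + d → a ∸ c ≡ d ∸ b
∸-exchange a b c d eq = begin
  a ∸ c             ≡⟨ ∸-cancel-+ a c b ⟨
  (a + b) ∸ (c + b) ≡⟨ cong (_∸ (c + b)) eq ⟩
  (c + d) ∸ (c + b) ≡⟨ [m+n]∸[m+o]≡n∸o c d b ⟩
  d ∸ b             ∎
  where open ≡-Reasoning

+-balance-≤ : ∀ {a b c d} → a + b ≡ c + d → c ≤ a → b ≤ d
+-balance-≤ {a} {b} {c} {d} eq c≤a = +-cancelˡ-≤ c b d (subst (c + b ≤_) eq (+-monoˡ-≤ b c≤a))

+-balance-< : ∀ {a b c d} → a + b ≡ c + d → c < a → b < d
+-balance-< {a} {b} {c} {d} eq c<a = +-cancelˡ-< c b d (subst (c + b <_) eq (+-monoˡ-< b c<a))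

module _ (n : ℕ) .{{_ : NonZero n}} where

  same-residue⇒multiple : ∀ {a b} → a % n ≡ b % n → a ≤ b → ∃ λ k → b ≡ a + k * n
  same-residue⇒multiple {a} {b} eq a≤b with m≤n⇒∃[o]m+o≡n (/-monoˡ-≤ n a≤b)
  ... | k , quotients = k , (begin
      b                           ≡⟨ m≡m%n+[m/n]*n b n ⟩
      b % n + (b / n) * n         ≡⟨ cong₂ (λ r q → r + q * n) (sym eq) (sym quotients) ⟩
      a % n + (a / n + k) * n     ≡⟨ cong (a % n +_) (*-distribʳ-+ n (a / n) k) ⟩
      a % n + ((a / n) * n + k * n) ≡⟨ +-assoc (a % n) _ _ ⟨
      a % n + (a / n) * n + k * n ≡⟨ cong (_+ k * n) (m≡m%n+[m/n]*n a n) ⟨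
      a + k * n                   ∎)
    where open ≡-Reasoning

  flush-down : ∀ {L} → Flush n L → ∀ k m → m + k * n ∈ L → m ∈ L
  flush-down {L} flush zero m p = subst (_∈ L) (+-identityʳ m) p
  flush-down {L} flush (suc k) m p with proj₂ (flush _ p)
  ... | inj₁ small = ⊥-elim (<⇒≱ small (≤-trans (m≤m+n n (k * n)) (m≤n+m _ m)))
  ... | inj₂ lower = flush-down flush k m (subst (_∈ L) peel lower)
    where
      peel : m + (n + k * n) ∸ n ≡ m + k * n
      peel = begin
        m + (n + k * n) ∸ n ≡⟨ cong (λ z → m + z ∸ n) (+-comm n (k * n)) ⟩
        m + (k * n + n) ∸ n ≡⟨ cong (_∸ n) (+-assoc m (k * n) n) ⟨
        m + k * n + n ∸ n   ≡⟨ m+n∸n≡m (m + k * n) n ⟩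
        m + k * n           ∎
        where open ≡-Reasoning

  flush-below-gap : ∀ {L y h} → Flush n L → y ∉ L → h ∈ L → h % n ≡ y % n → n + h ≤ y
  flush-below-gap {y = y} {h} flush y∉L h∈L same with ≤-total y h
  ... | inj₁ y≤h with same-residue⇒multiple (sym same) y≤h
  ...   | k , h≡ = ⊥-elim (y∉L (flush-down flush k y (subst (_∈ _) h≡ h∈L)))
  flush-below-gap {y = y} {h} flush y∉L h∈L same | inj₂ h≤y with same-residue⇒multiple same h≤y
  ...   | zero , y≡ = ⊥-elim (y∉L (subst (_∈ _) (sym (trans y≡ (+-identityʳ h))) h∈L))
  ...   | suc k , y≡ = subst (n + h ≤_) (sym y≡)
                         (≤-trans (≤-reflexive (+-comm n h)) (+-monoʳ-≤ h (m≤m+n n (k * n))))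

  s-cons-match : ∀ {h} L {i} → h % n ≡ i → s n (h ∷ L) i ≡ (n + h) ⊔ s n L i
  s-cons-match {h} L {i} e with h % n ≡ᵇ i in b
  ... | true = refl
  ... | false = ⊥-elim (subst T b (≡⇒≡ᵇ _ _ e))

  s-cons-skip : ∀ {h} L {i} → h % n ≢ i → s n (h ∷ L) i ≡ s n L i
  s-cons-skip {h} L {i} ne with h % n ≡ᵇ i in b
  ... | true = ⊥-elim (ne (≡ᵇ⇒≡ _ _ (subst T (sym b) tt)))
  ... | false = refl

  s-default-≤ : ∀ L i → i ≤ s n L i
  s-default-≤ [] i = ≤-refl
  s-default-≤ (h ∷ L) i with h % n ≟ i
  ... | yes e = subst (i ≤_) (sym (s-cons-match L e)) (≤-trans (s-default-≤ L i) (m≤n⊔m (n + h) _))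
  ... | no ne = subst (i ≤_) (sym (s-cons-skip L ne)) (s-default-≤ L i)

  s-member-≤ : ∀ {L i h} → h ∈ L → h % n ≡ i → n + h ≤ s n L i
  s-member-≤ {h ∷ L} (here refl) e = subst (n + h ≤_) (sym (s-cons-match L e)) (m≤m⊔n (n + h) _)
  s-member-≤ {h′ ∷ L} {i} {h} (there p) e with h′ % n ≟ i
  ... | yes e′ = subst (n + h ≤_) (sym (s-cons-match L e′)) (≤-trans (s-member-≤ p e) (m≤n⊔m (n + h′) _))
  ... | no ne = subst (n + h ≤_) (sym (s-cons-skip L ne)) (s-member-≤ p e)

  s-cons-cases : ∀ h L i → s n (h ∷ L) i ≡ s n L i ⊎ (h % n ≡ i × s n (h ∷ L) i ≡ n + h)
  s-cons-cases h L i with h % n ≟ i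
  ... | no ne = inj₁ (s-cons-skip L ne)
  ... | yes r with ≤-total (n + h) (s n L i)
  ...   | inj₁ le = inj₁ (trans (s-cons-match L r) (m≤n⇒m⊔n≡n le))
  ...   | inj₂ ge = inj₂ (r , trans (s-cons-match L r) (m≥n⇒m⊔n≡m ge))

  s-attained : ∀ L i → s n L i ≡ i ⊎ ∃ λ h → h ∈ L × h % n ≡ i × s n L i ≡ n + h
  s-attained [] i = inj₁ refl
  s-attained (h ∷ L) i with s-cons-cases h L i
  ... | inj₂ (r , e) = inj₂ (h , here refl , r , e)
  ... | inj₁ same = Sum.map (trans same) (λ (h′ , p , r , e) → h′ , there p , r , trans same e) (s-attained L i)

  s-residue : ∀ L {i} → i < n → s n L i % n ≡ i
  s-residue L {i} i<n with s-attained L i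
  ... | inj₁ e = trans (cong (_% n) e) (m<n⇒m%n≡m i<n)
  ... | inj₂ (h , _ , r , e) = trans (cong (_% n) e) (trans (cong (_% n) (+-comm n h)) (trans ([m+n]%n≡m%n h n) r))

  FirstGap : List ℕ → ℕ → Set
  FirstGap L y = y ∉ L × (y < n ⊎ y ∸ n ∈ L)

  S⇒FirstGap : ∀ {L y} → y ∈ S n L → FirstGap L y
  S⇒FirstGap {L} yS with ∈-map⁻ (s n L) yS
  ... | i , i∈ , refl = not-member , below
    where
      i<n : i < n
      i<n = ∈-upTo⁻ i∈
      not-member : s n L i ∉ L
      not-member p = <⇒≱ (m<n+m (s n L i) (>-nonZero⁻¹ n)) (s-member-≤ p (s-residue L i<n))
      below : s n L i < n ⊎ s n L i ∸ n ∈ L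
      below with s-attained L i
      ... | inj₁ e = inj₁ (subst (_< n) (sym e) i<n)
      ... | inj₂ (h , h∈L , _ , e) = inj₂ (subst (_∈ L) (sym (trans (cong (_∸ n) e) (m+n∸m≡n n h))) h∈L)

  -- For n-flush L every first gap y lies in Sⁿ(L): it equals s_i for i = y % n.
  FirstGap⇒S : ∀ {L y} → Flush n L → FirstGap L y → y ∈ S n L
  FirstGap⇒S {L} {y} flush (y∉L , below) =
    subst (_∈ S n L) (sym (≤-antisym (y≤s below) s≤y)) (∈-map⁺ (s n L) (∈-upTo⁺ (m%n<n y n)))
    where
      i : ℕ
      i = y % n
      s≤y : s n L i ≤ y
      s≤y with s-attained L i
      ... | inj₁ e = subst (_≤ y) (sym e) (m%n≤m y n)
      ... | inj₂ (h , h∈L , r , e) = subst (_≤ y) (sym e) (flush-below-gap flush y∉L h∈L r)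
      small≤s : y < n → y ≤ s n L i
      small≤s y<n = subst (_≤ s n L i) (m<n⇒m%n≡m y<n) (s-default-≤ L i)
      y≤s : y < n ⊎ y ∸ n ∈ L → y ≤ s n L i
      y≤s (inj₁ y<n) = small≤s y<n
      y≤s (inj₂ p) with n ≤? y
      ... | no n≰y = small≤s (≰⇒> n≰y)
      ... | yes n≤y = subst (_≤ s n L i) (m+[n∸m]≡n n≤y) (s-member-≤ p (m≤n⇒[n∸m]%m≡n%m n≤y))

Complement : ℕ → List ℕ → (ℕ → Set) → Set
Complement h A B = ∀ g → B g ⇔ (g ≤ h × h ∸ g ∉ A)

Bounded : ℕ → List ℕ → Set
Bounded h A = ∀ a → a ∈ A → a ≤ h

complement-resp : ∀ {h A} {P Q : ℕ → Set} → (∀ g → P g ⇔ Q g) → Complement h A Q → Complement h A P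
complement-resp P⇔Q C g = mk⇔ (to (C g) ∘ to (P⇔Q g)) (from (P⇔Q g) ∘ from (C g))

complement-sym : ∀ {h A B} → Bounded h A → Complement h A (_∈ B) → Complement h B (_∈ A)
complement-sym {h} {A} {B} bounded C a = mk⇔ forward backward
  where
    forward : a ∈ A → a ≤ h × h ∸ a ∉ B
    forward a∈A = bounded a a∈A ,
      λ p → proj₂ (to (C _) p) (subst (_∈ A) (sym (m∸[m∸n]≡n (bounded a a∈A))) a∈A)
    backward : a ≤ h × h ∸ a ∉ B → a ∈ A
    backward (a≤h , gap) with a ∈? A
    ... | yes a∈A = a∈A
    ... | no a∉A = ⊥-elim (gap (from (C _) (m∸n≤m h a , λ p → a∉A (subst (_∈ A) (m∸[m∸n]≡n a≤h) p))))

module _ (n : ℕ) .{{_ : NonZero n}} {h : ℕ} {A B : List ℕ} where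

  flush-complement : Flush n A → h ∈ A → Complement h A (_∈ B) → Flush n B
  flush-complement flushA h∈A C g g∈B = not-multiple , descends
    where
      g≤h : g ≤ h
      g≤h = proj₁ (to (C g) g∈B)
      gap : h ∸ g ∉ A
      gap = proj₂ (to (C g) g∈B)
      -- if n ∣ g then h - g is congruent to h ∈ A and below it, hence in A
      not-multiple : ¬ (n ∣ g)
      not-multiple (divides q g≡qn) =
        gap (flush-down n flushA q (h ∸ g) (subst (_∈ A) (trans (sym (m∸n+n≡m g≤h)) (cong (h ∸ g +_) g≡qn)) h∈A))
      -- h - (g - n) = (h - g) + n, which lies in A only if h - g does
      lifted-gap : n ≤ g → h ∸ (g ∸ n) ∉ A
      lifted-gap n≤g p with proj₂ (flushA _ p)
      ... | inj₁ small = <⇒≱ small (m+n≤o⇒m≤o∸n n (subst (_≤ h) (sym (m+[n∸m]≡n n≤g)) g≤h))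
      ... | inj₂ lower = gap (subst (_∈ A) (trans (∸-+-assoc h (g ∸ n) n) (cong (h ∸_) (m∸n+n≡m n≤g))) lower)
      descends : g < n ⊎ g ∸ n ∈ B
      descends with n ≤? g
      ... | no n≰g = inj₁ (≰⇒> n≰g)
      ... | yes n≤g = inj₂ (from (C (g ∸ n)) (≤-trans (m∸n≤m g n) g≤h , lifted-gap n≤g))

  firstGap-reflect : Complement h A (_∈ B) → ∀ {y t} → y + t ≡ h + n → FirstGap n A y → FirstGap n B t
  firstGap-reflect C {y} {t} eq (y∉A , y-below) = t∉B , t-below
    where
      t∉B : t ∉ B
      t∉B t∈B = Sum.[ (λ y<n → <⇒≱ y<n n≤y) , (λ lower → gap (subst (_∈ A) y∸n≡h∸t lower)) ] y-below
        where
          gap : h ∸ t ∉ A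
          gap = proj₂ (to (C t) t∈B)
          n≤y : n ≤ y
          n≤y = +-balance-≤ (trans (sym eq) (+-comm y t)) (proj₁ (to (C t) t∈B))
          y∸n≡h∸t : y ∸ n ≡ h ∸ t
          y∸n≡h∸t = ∸-exchange y t n h (trans eq (+-comm h n))
      t-below : t < n ⊎ t ∸ n ∈ B
      t-below with y ≤? h
      ... | no y≰h = inj₁ (+-balance-< eq (≰⇒> y≰h))
      ... | yes y≤h = inj₂ (subst (_∈ B) (∸-exchange h n y t (sym eq))
              (from (C (h ∸ y)) (m∸n≤m h y , λ p → y∉A (subst (_∈ A) (m∸[m∸n]≡n y≤h) p))))

module _ (n : ℕ) .{{_ : NonZero n}} {h : ℕ} {A : List ℕ} where

  firstGap-bounded : Bounded h A → ∀ {y} → FirstGap n A y → y ≤ h + n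
  firstGap-bounded bounded (_ , inj₁ y<n) = ≤-trans (<⇒≤ y<n) (m≤n+m n h)
  firstGap-bounded bounded {y} (_ , inj₂ lower) =
    ≤-trans (m≤n+m∸n y n) (subst (n + (y ∸ n) ≤_) (+-comm n h) (+-monoʳ-≤ n (bounded _ lower)))

  complement-reflection : ∀ {B} → Flush n A → h ∈ A → Bounded h A → Complement h A (_∈ B)
    → Flush n B × (∀ y → (y ∈ S n A) ⇔ (∃ λ t → t ∈ S n B × y + t ≡ h + n))
  complement-reflection {B} flushA h∈A bounded C = flushB , λ y → mk⇔ (forward y) (backward y)
    where
      flushB : Flush n B
      flushB = flush-complement n flushA h∈A C
      forward : ∀ y → y ∈ S n A → ∃ λ t → t ∈ S n B × y + t ≡ h + n
      forward y yS = h + n ∸ y , FirstGap⇒S n flushB (firstGap-reflect n C eq gap) , eq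
        where
          gap : FirstGap n A y
          gap = S⇒FirstGap n yS
          eq : y + (h + n ∸ y) ≡ h + n
          eq = m+[n∸m]≡n (firstGap-bounded bounded gap)
      backward : ∀ y → (∃ λ t → t ∈ S n B × y + t ≡ h + n) → y ∈ S n A
      backward y (t , tS , eq) = FirstGap⇒S n flushA
        (firstGap-reflect n (complement-sym bounded C) (trans (+-comm t y) eq) (S⇒FirstGap n tS))

-- Number of parts of l exceeding j, i.e. the length of column j + 1 of the diagram of l.
columnLength : ℕ → List ℕ → ℕ
columnLength j l = length (filter (suc j ≤?_) l)

columnLength-cons : ∀ {j x} xs → j < x → columnLength j (x ∷ xs) ≡ suc (columnLength j xs)
columnLength-cons {j} {x} xs j<x = cong length (filter-accept (suc j ≤?_) {x} {xs} j<x)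

columnLength-none : ∀ {j} l → All (_≤ j) l → columnLength j l ≡ 0
columnLength-none {j} l short = cong length (filter-none (suc j ≤?_) (All.map ≤⇒≯ short))

parts-≤-first : ∀ {x xs} → Linked _≥_ (x ∷ xs) → All (_≤ x) (x ∷ xs)
parts-≤-first = Linked⇒All (λ x≥y y≥z → ≤-trans y≥z x≥y) ≤-refl

maxPart-first : ∀ {x xs} → Linked _≥_ (x ∷ xs) → maxPart (x ∷ xs) ≡ x
maxPart-first {x} [-] = ⊔-identityʳ x
maxPart-first {x} (x≥y ∷ desc) = trans (cong (x ⊔_) (maxPart-first desc)) (m≥n⇒m⊔n≡m x≥y)

H-bounded : ∀ {x xs} → Linked _≥_ (x ∷ xs) → Bounded (x + length xs) (H (x ∷ xs))
H-bounded desc _ (here refl) = ≤-refl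
H-bounded [-] _ (there ())
H-bounded {x} (x≥y ∷ desc) e (there p) = ≤-trans (H-bounded desc e p) (+-mono-≤ x≥y (n≤1+n _))

H-applyUpTo⁺ : ∀ (f : ℕ → ℕ) m j → j < m → f j + (m ∸ suc j) ∈ H (applyUpTo f m)
H-applyUpTo⁺ f (suc m) zero _ = here (cong (f 0 +_) (sym (length-applyUpTo (f ∘ suc) m)))
H-applyUpTo⁺ f (suc m) (suc j) (s≤s j<m) = there (H-applyUpTo⁺ (f ∘ suc) m j j<m)

H-applyUpTo⁻ : ∀ (f : ℕ → ℕ) m {g} → g ∈ H (applyUpTo f m) → ∃ λ j → j < m × g ≡ f j + (m ∸ suc j)
H-applyUpTo⁻ f (suc m) (here e) = 0 , z<s , trans e (cong (f 0 +_) (length-applyUpTo (f ∘ suc) m))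
H-applyUpTo⁻ f (suc m) (there p) with H-applyUpTo⁻ (f ∘ suc) m p
... | j , j<m , e = suc j , s≤s j<m , e

-- g is the hook length of the box in row 1, column j + 1 of x ∷ xs:
-- x - j boxes of arm (counting the box itself) plus the boxes below it.
FirstRowHook : ℕ → List ℕ → ℕ → Set
FirstRowHook x xs g = ∃ λ j → j < x × g ≡ (x ∸ j) + columnLength j xs

conj-columns : ∀ {x xs} → Linked _≥_ (x ∷ xs) → conj (x ∷ xs) ≡ applyUpTo (λ j → columnLength j (x ∷ xs)) x
conj-columns {x} {xs} desc = trans (map-upTo _ (maxPart (x ∷ xs))) (cong (applyUpTo _) (maxPart-first desc))

-- The first-column hook of λᵀ in row j + 1 is the first-row hook of λ in column j + 1.
column-hook : ∀ {j x} xs → j < x → columnLength j (x ∷ xs) + (x ∸ suc j) ≡ (x ∸ j) + columnLength j xs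
column-hook {j} {x} xs j<x = begin
  columnLength j (x ∷ xs) + (x ∸ suc j) ≡⟨ cong (_+ (x ∸ suc j)) (columnLength-cons xs j<x) ⟩
  suc (columnLength j xs + (x ∸ suc j)) ≡⟨ cong suc (+-comm (columnLength j xs) (x ∸ suc j)) ⟩
  suc (x ∸ suc j) + columnLength j xs   ≡⟨ cong (_+ columnLength j xs) (+-∸-assoc 1 j<x) ⟨
  (x ∸ j) + columnLength j xs           ∎
  where open ≡-Reasoning

conj-hooks : ∀ {x xs} → Linked _≥_ (x ∷ xs) → ∀ g → (g ∈ H (conj (x ∷ xs))) ⇔ FirstRowHook x xs g
conj-hooks {x} {xs} desc g = mk⇔
  (λ p → hook (H-applyUpTo⁻ f x (subst (λ l → g ∈ H l) (conj-columns desc) p)))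
  (λ (j , j<x , e) → subst (λ l → g ∈ H l) (sym (conj-columns desc))
    (subst (_∈ H (applyUpTo f x)) (sym (trans e (sym (column-hook xs j<x)))) (H-applyUpTo⁺ f x j j<x)))
  where
    f : ℕ → ℕ
    f j = columnLength j (x ∷ xs)
    hook : (∃ λ j → j < x × g ≡ f j + (x ∸ suc j)) → FirstRowHook x xs g
    hook (j , j<x , e) = j , j<x , trans e (column-hook xs j<x)

-- Adding a row of length y + d on top of y ∷ ys: a column j < y gains one box and d arm boxes.
long-column-hook : ∀ {y d j} ys → j < y
  → (y + d ∸ j) + columnLength j (y ∷ ys) ≡ ((y ∸ j) + columnLength j ys) + suc d
long-column-hook {y} {d} {j} ys j<y = begin
  (y + d ∸ j) + columnLength j (y ∷ ys)       ≡⟨ cong₂ _+_ (+-∸-comm d (<⇒≤ j<y)) (columnLength-cons ys j<y) ⟩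
  ((y ∸ j) + d) + suc (columnLength j ys)     ≡⟨ swap (y ∸ j) d (columnLength j ys) ⟩
  ((y ∸ j) + columnLength j ys) + suc d       ∎
  where
    open ≡-Reasoning
    swap : ∀ a d c → (a + d) + suc c ≡ (a + c) + suc d
    swap = solve-∀

-- Over parts that are all ≤ y, the first-row boxes in columns y + 1, …, y + d
-- have exactly the hook lengths 1, …, d.
short-column-hook : ∀ {y d j} l → All (_≤ y) l → y ≤ j → j < y + d
  → 0 < (y + d ∸ j) + columnLength j l × (y + d ∸ j) + columnLength j l ≤ d
short-column-hook {y} {d} {j} l short y≤j j<x =
  subst (λ g → 0 < g × g ≤ d) (sym hook≡arm) (m<n⇒0<n∸m j<x , ≤-trans (∸-monoʳ-≤ (y + d) y≤j) (≤-reflexive (m+n∸m≡n y d)))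
  where
    hook≡arm : (y + d ∸ j) + columnLength j l ≡ y + d ∸ j
    hook≡arm = trans (cong (y + d ∸ j +_) (columnLength-none l (All.map (λ p → ≤-trans p y≤j) short))) (+-identityʳ _)

short-column-hook⁻ : ∀ {y d g} l → All (_≤ y) l → 0 < g → g ≤ d → FirstRowHook (y + d) l g
short-column-hook⁻ {y} {d} {g} l short 0<g g≤d = j , ∸-monoʳ-< 0<g g≤x , sym hook≡g
  where
    g≤x : g ≤ y + d
    g≤x = ≤-trans g≤d (m≤n+m d y)
    j : ℕ
    j = y + d ∸ g
    y≤j : y ≤ j
    y≤j = m+n≤o⇒m≤o∸n y (+-monoʳ-≤ y g≤d)
    hook≡g : (y + d ∸ j) + columnLength j l ≡ g
    hook≡g = trans (cong₂ _+_ (m∸[m∸n]≡n g≤x) (columnLength-none l (All.map (λ p → ≤-trans p y≤j) short))) (+-identityʳ g)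

rowHooks-single : ∀ x g → FirstRowHook x [] g ⇔ (0 < g × g ≤ x)
rowHooks-single x g = mk⇔
  (λ (j , j<x , e) → subst (λ g → 0 < g × g ≤ x) (sym e) (short-column-hook {0} [] [] z≤n j<x))
  (λ (0<g , g≤x) → short-column-hook⁻ {0} [] [] 0<g g≤x)

rowHooks-cons : ∀ {y d} ys → Linked _≥_ (y ∷ ys) → ∀ g
  → FirstRowHook (y + d) (y ∷ ys) g ⇔ ((0 < g × g ≤ d) ⊎ ∃ λ g′ → FirstRowHook y ys g′ × g ≡ g′ + suc d)
rowHooks-cons {y} {d} ys desc g = mk⇔ forward backward
  where
    forward : FirstRowHook (y + d) (y ∷ ys) g → (0 < g × g ≤ d) ⊎ ∃ λ g′ → FirstRowHook y ys g′ × g ≡ g′ + suc d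
    forward (j , j<x , e) with j <? y
    ... | yes j<y = inj₂ (_ , (j , j<y , refl) , trans e (long-column-hook ys j<y))
    ... | no j≮y = inj₁ (subst (λ g → 0 < g × g ≤ d) (sym e) (short-column-hook (y ∷ ys) (parts-≤-first desc) (≮⇒≥ j≮y) j<x))
    backward : (0 < g × g ≤ d) ⊎ (∃ λ g′ → FirstRowHook y ys g′ × g ≡ g′ + suc d) → FirstRowHook (y + d) (y ∷ ys) g
    backward (inj₁ (0<g , g≤d)) = short-column-hook⁻ (y ∷ ys) (parts-≤-first desc) 0<g g≤d
    backward (inj₂ (g′ , (j , j<y , e′) , e)) =
      j , <-≤-trans j<y (m≤m+n y d) , trans e (trans (cong (_+ suc d) e′) (sym (long-column-hook ys j<y)))

gap-nonzero : ∀ {h A g} → h ∸ g ∉ h ∷ A → 0 < g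
gap-nonzero {g = zero} gap = ⊥-elim (gap (here refl))
gap-nonzero {g = suc g} _ = z<s

complement-single : ∀ h → Complement h (h ∷ []) (λ g → 0 < g × g ≤ h)
complement-single h g = mk⇔
  (λ (0<g , g≤h) → g≤h , λ { (here e) → <⇒≢ (∸-monoʳ-< 0<g g≤h) e })
  (λ (g≤h , gap) → gap-nonzero gap , g≤h)

complement-extend : ∀ {h d A} {P P′ : ℕ → Set} → Bounded h A → Complement h A P
  → (∀ g → P′ g ⇔ ((0 < g × g ≤ d) ⊎ ∃ λ g′ → P g′ × g ≡ g′ + suc d))
  → Complement (h + suc d) ((h + suc d) ∷ A) P′
complement-extend {h} {d} {A} {P} bounded C step g =
  mk⇔ (forward ∘ to (step g)) (from (step g) ∘ backward)
  where
    h′ : ℕ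
    h′ = h + suc d
    forward : (0 < g × g ≤ d) ⊎ (∃ λ g′ → P g′ × g ≡ g′ + suc d) → g ≤ h′ × h′ ∸ g ∉ h′ ∷ A
    forward (inj₁ (0<g , g≤d)) = g≤h′ , λ where
        (here e) → <⇒≢ (∸-monoʳ-< 0<g g≤h′) e
        (there p) → <⇒≱ above-h (bounded _ p)
      where
        g≤h′ : g ≤ h′
        g≤h′ = ≤-trans g≤d (≤-trans (n≤1+n d) (m≤n+m (suc d) h))
        -- a new short-column hook reflects to a value strictly between h and h′
        above-h : h < h′ ∸ g
        above-h = m+n≤o⇒m≤o∸n (suc h) (subst (suc (h + g) ≤_) (sym (+-suc h d)) (s≤s (+-monoʳ-≤ h g≤d)))
    forward (inj₂ (g′ , Pg′ , refl)) = +-monoˡ-≤ (suc d) (proj₁ (to (C g′) Pg′)) , λ where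
        (here e) → <⇒≢ (≤-<-trans (m∸n≤m h g′) (m<m+n h z<s)) (trans (sym (∸-cancel-+ h g′ (suc d))) e)
        (there p) → proj₂ (to (C g′) Pg′) (subst (_∈ A) (∸-cancel-+ h g′ (suc d)) p)
    backward : g ≤ h′ × h′ ∸ g ∉ h′ ∷ A → (0 < g × g ≤ d) ⊎ (∃ λ g′ → P g′ × g ≡ g′ + suc d)
    backward (g≤h′ , gap) with g ≤? d
    ... | yes g≤d = inj₁ (gap-nonzero gap , g≤d)
    ... | no g≰d = inj₂ (g ∸ suc d , from (C _) (g′≤h , λ p → gap (there (subst (_∈ A) reflected p))) , sym (m∸n+n≡m d<g))
      where
        d<g : d < g
        d<g = ≰⇒> g≰d
        g′≤h : g ∸ suc d ≤ h
        g′≤h = subst (g ∸ suc d ≤_) (m+n∸n≡m h (suc d)) (∸-monoˡ-≤ (suc d) g≤h′)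
        reflected : h ∸ (g ∸ suc d) ≡ h′ ∸ g
        reflected = trans (sym (∸-cancel-+ h (g ∸ suc d) (suc d))) (cong (h′ ∸_) (m∸n+n≡m d<g))

rowHooks-complement : ∀ x xs → Linked _≥_ (x ∷ xs) → Complement (x + length xs) (H (x ∷ xs)) (FirstRowHook x xs)
rowHooks-complement x [] _ = subst (λ h → Complement h (h ∷ []) (FirstRowHook x [])) (sym (+-identityʳ x))
  (complement-resp (rowHooks-single x) (complement-single x))
rowHooks-complement x (y ∷ ys) (y≤x ∷ desc) with m≤n⇒∃[o]m+o≡n y≤x
... | d , refl = subst (λ h → Complement h (h ∷ H (y ∷ ys)) (FirstRowHook (y + d) (y ∷ ys))) (corner y d (length ys))
  (complement-extend (H-bounded desc) (rowHooks-complement y ys desc) (rowHooks-cons ys desc))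
  where
    corner : ∀ y d r → (y + r) + suc d ≡ (y + d) + suc r
    corner = solve-∀

conj-complement : ∀ x xs → Linked _≥_ (x ∷ xs) → Complement (x + length xs) (H (x ∷ xs)) (_∈ H (conj (x ∷ xs)))
conj-complement x xs desc = complement-resp (conj-hooks desc) (rowHooks-complement x xs desc)

theorem3p1 : (n : ℕ) → .{{_ : NonZero n}} → (x : ℕ) → (xs : List ℕ)
    → IsPartition (x ∷ xs)
    → Flush n (H (x ∷ xs))
    → Flush n (H (conj (x ∷ xs)))
      × (∀ y → (y ∈ S n (H (x ∷ xs)))
               ⇔ (∃ λ t → t ∈ S n (H (conj (x ∷ xs))) × y + t ≡ (x + length xs) + n))
theorem3p1 n x xs (_ , desc) flush =
  complement-reflection n flush (here refl) (H-bounded desc) (conj-complement x xs desc)
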